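{- Let $F\colon\mathbf{Set}\to\mathbf{Set}$ be a functor preserving weak pullbacks that has a separating set of monotone predicate liftings, let $\alpha\colon X\to FX$ be a coalgebra with $X$ finite, and let $R_n,T,I$ be the output of the partition refinement algorithm described in the context. Then for every $(x_0,x_1)\notin R_n$, the formula $\varphi_{x_0,x_1}$ constructed in the context (using cone modalities) satisfies $x_0\models\varphi_{x_0,x_1}$ and $x_1\not\models\varphi_{x_0,x_1}$.
   Context: Lifted order: for a preorder $\le$ on $Y$, $t_0\le^F t_1$ in $FY$ iff there is $t\in F(\le)$ with $F\pi_i(t)=t_i$, $\pi_i\colon{\le}\to Y$ the projections; we use $2=\{0,1\}$, $0\le 1$. An evaluation map $\lambda\colon F2\to2$ induces the predicate lifting $p\mapsto\lambda\circ Fp$; monotone means monotone w.r.t. $\le^F$; a set $\Lambda$ of evaluation maps is separating if for all sets $X$ and $t_0\neq t_1\in FX$ there exist $\lambda\in\Lambda$, $p\colon X\to2$ with $\lambda(Fp(t_0))\ne\lambda(Fp(t_1))$. $\chi_P$ is the characteristic function of $P$; $E(R)$ is the set of classes of an equivalence relation $R$. Modal logic: formulas $\phi::=\bigwedge\Phi\mid\neg\phi\mid[\lambda]\phi$ for sets $\Phi$ of formulas and evaluation maps $\lambda$; semantics $[\![\phi]\!]\colon X\to2$ with conjunction/negation as usual and $[\![[\lambda]\phi]\!]=\lambda\circ F[\![\phi]\!]\circ\alpha$; $x\models\phi$ iff $[\![\phi]\!](x)=1$; $\mathit{tt}$ is the empty conjunction, $\bigvee$ the derived disjunction. For $v\in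 F2$ the cone modality $\uparrow v\colon F2\to 2$ is $\uparrow v(u)=1$ iff $v\le^F u$. Algorithm: initially $I(x,y)=\infty$ for all pairs, $R_0=X\times X$, $i=0$. Repeat: $i:=i+1$, $R_i:=R_{i-1}$; for every $(x,y)\in R_{i-1}$ and $P\in E(R_{i-1})$: if $F\chi_P(\alpha(x))\not\le^F F\chi_P(\alpha(y))$, set $T(x,y):=(x,P)$, $I(x,y):=i$, remove $(x,y)$ from $R_i$; else if $F\chi_P(\alpha(y))\not\le^F F\chi_P(\alpha(x))$, set $T(x,y):=(y,P)$, $I(x,y):=i$, remove $(x,y)$ from $R_i$. Stop when $R_i=R_{i-1}$; $R_n$ is the final relation. Construction of $\varphi_{x_0,x_1}$ for $(x_0,x_1)\notin R_n$, by recursion on $I(x_0,x_1)$: let $T(x_0,x_1)=(s,P)$. Define $\phi=\mathit{tt}$ if $I(x_0,x_1)=1$, and $\phi=\bigvee_{x_0'\in P}\bigwedge_{x_1'\in X\setminus P}\varphi_{x_0',x_1'}$ if $I(x_0,x_1)>1$ (here $I(x_0',x_1')<I(x_0,x_1)$). If $s=x_0$, let $v=F\chi_P(\alpha(x_0))$ and $\varphi_{x_0,x_1}=[\uparrow v]\phi$; if $s=x_1$, let $v=F\chi_P(\alpha(x_1))$ and $\varphi_{x_0,x_1}=\neg[\uparrow v]\phi$. -}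

module Defs where

open import Level using (0ℓ)
open import Function using (id; _∘_)
open import Function.Bundles using (_⇔_)
open import Data.Bool using (Bool; true; false; not; _∧_; if_then_else_) renaming (_≤_ to _≤B_)
open import Data.Nat using (ℕ; zero; suc; _<_)
open import Data.Fin using (Fin; _≟_)
open import Data.List using (List; []; _∷_; map; allFin)
open import Data.Maybe using (Maybe; just; nothing)
open import Data.Product using (Σ; ∃; _×_; _,_; proj₁; proj₂)
open import Data.Sum using (_⊎_)
open import Relation.Nullary using (¬_; does)
open import Relation.Binary.PropositionalEquality using (_≡_; _≢_)

-- Endofunctors on Set (functions treated extensionally: fmap-cong)

record Functor : Set₁ where
  field
    F       : Set → Set
    fmap    : ∀ {A B : Set} → (A → B) → F A → F B
    fmap-id : ∀ {A : Set} (t : F A) → fmap id t ≡ t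
    fmap-∘  : ∀ {A B C : Set} (f : A → B) (g : B → C) (t : F A) →
              fmap (g ∘ f) t ≡ fmap g (fmap f t)
    fmap-cong : ∀ {A B : Set} {f g : A → B} → (∀ a → f a ≡ g a) →
              ∀ t → fmap f t ≡ fmap g t

IsWeakPullback : {A B C P : Set} (f : A → C) (g : B → C)
                 (p₁ : P → A) (p₂ : P → B) → Set
IsWeakPullback {A} {B} {C} {P} f g p₁ p₂ =
  (∀ p → f (p₁ p) ≡ g (p₂ p)) ×
  (∀ (a : A) (b : B) → f a ≡ g b → Σ P λ p → p₁ p ≡ a × p₂ p ≡ b)

PreservesWeakPullbacks : Functor → Set₁
PreservesWeakPullbacks Fu =
  ∀ {A B C P : Set} (f : A → C) (g : B → C) (p₁ : P → A) (p₂ : P → B) →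
  IsWeakPullback f g p₁ p₂ →
  IsWeakPullback (fmap f) (fmap g) (fmap p₁) (fmap p₂)
  where open Functor Fu

-- 2 = Bool with false ≤ true  (Data.Bool._≤_)

module _ (Fu : Functor) where
  open Functor Fu

  Lift : {Y : Set} → (Y → Y → Set) → F Y → F Y → Set
  Lift {Y} _≤_ t₀ t₁ =
    Σ (F (Σ (Y × Y) (λ q → proj₁ q ≤ proj₂ q))) λ t →
      fmap (proj₁ ∘ proj₁) t ≡ t₀ × fmap (proj₂ ∘ proj₁) t ≡ t₁

  _≤F₂_ : F Bool → F Bool → Set
  _≤F₂_ = Lift _≤B_

  -- evaluation maps λ : F2 → 2 (inducing predicate liftings p ↦ λ ∘ Fp)
  EvalMap : Set
  EvalMap = F Bool → Bool

  Monotone : EvalMap → Set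
  Monotone l = ∀ u v → u ≤F₂ v → l u ≤B l v

  Separating : (EvalMap → Set) → Set₁
  Separating Λ =
    ∀ (X : Set) (t₀ t₁ : F X) → t₀ ≢ t₁ →
    Σ EvalMap λ l → Λ l × Σ (X → Bool) λ p → l (fmap p t₀) ≢ l (fmap p t₁)

  HasSepMonotoneLiftings : Set₁
  HasSepMonotoneLiftings =
    Σ (EvalMap → Set) λ Λ → (∀ l → Λ l → Monotone l) × Separating Λ

  data Formula : Set where
    ⋀    : List Formula → Formula
    ¬'   : Formula → Formula
    [_]_ : EvalMap → Formula → Formula

  tt : Formula
  tt = ⋀ []

  ⋁ : List Formula → Formula
  ⋁ Φ = ¬' (⋀ (map ¬' Φ))

  module Semantics {X : Set} (α : X → F X) where
    mutual
      ⟦_⟧ : Formula → X → Bool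
      ⟦ ⋀ Φ ⟧ x     = ⟦ Φ ⟧* x
      ⟦ ¬' φ ⟧ x    = not (⟦ φ ⟧ x)
      ⟦ [ l ] φ ⟧ x = l (fmap ⟦ φ ⟧ (α x))

      ⟦_⟧* : List Formula → X → Bool
      ⟦ [] ⟧* x    = true
      ⟦ φ ∷ Φ ⟧* x = ⟦ φ ⟧ x ∧ ⟦ Φ ⟧* x

    _⊨_ : X → Formula → Set
    x ⊨ φ = ⟦ φ ⟧ x ≡ true

  IsCone : (F Bool → F Bool → Bool) → Set
  IsCone cone = ∀ v u → (cone v u ≡ true) ⇔ (v ≤F₂ u)

  module Algorithm {n : ℕ} (α : Fin n → F (Fin n)) where
    X : Set
    X = Fin n

    BRel : Set
    BRel = X → X → Bool

    IsClass : BRel → (X → Bool) → Set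
    IsClass R P = Σ X λ x₀ → ∀ x → P x ≡ R x₀ x

    Trig₁ : BRel → X → X → (X → Bool) → Set
    Trig₁ R x y P = IsClass R P × ¬ (fmap P (α x) ≤F₂ fmap P (α y))

    Trig₂ : BRel → X → X → (X → Bool) → Set
    Trig₂ R x y P = IsClass R P × (fmap P (α x) ≤F₂ fmap P (α y))
                                × ¬ (fmap P (α y) ≤F₂ fmap P (α x))

    Removed : BRel → X → X → Set
    Removed R x y = Σ (X → Bool) λ P → Trig₁ R x y P ⊎ Trig₂ R x y P

    Step : BRel → BRel → Set
    Step R R' = ∀ x y → (R' x y ≡ true) ⇔ (R x y ≡ true × ¬ Removed R x y)

    -- T(x,y) = (s,P) is a value that the algorithm may record in a round on R
    TSpec : BRel → X → X → X × (X → Bool) → Set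
    TSpec R x y (s , P) = (s ≡ x × Trig₁ R x y P) ⊎ (s ≡ y × Trig₂ R x y P)

    -- A complete run: relations Rs 0, Rs 1, …; the loop stops at round
    -- suc m (the first i with Rs i = Rs (i-1)); final relation Rs (suc m);
    -- I (nothing = ∞) and T as recorded by the algorithm.
    record IsRun (Rs : ℕ → BRel) (m : ℕ) (I : X → X → Maybe ℕ)
                 (T : X → X → X × (X → Bool)) : Set where
      field
        start   : ∀ x y → Rs 0 x y ≡ true
        step    : ∀ i → Step (Rs i) (Rs (suc i))
        stop    : ∀ x y → Rs (suc m) x y ≡ Rs m x y
        nostop  : ∀ i → i < m → Σ X λ x → Σ X λ y → Rs (suc i) x y ≢ Rs i x y
        I-final : ∀ x y → Rs (suc m) x y ≡ true → I x y ≡ nothing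
        removed : ∀ x y → Rs (suc m) x y ≡ false →
                  Σ ℕ λ i → I x y ≡ just (suc i) × Rs i x y ≡ true
                          × Rs (suc i) x y ≡ false × TSpec (Rs i) x y (T x y)

    filterB : (X → Bool) → List X → List X
    filterB p []       = []
    filterB p (x ∷ xs) = if p x then x ∷ filterB p xs else filterB p xs

    -- construction of φ_{x₀,x₁} by recursion on I(x₀,x₁); the natural
    -- number argument is only a termination measure (instantiated with I)
    module Construction (cone : F Bool → F Bool → Bool)
                        (I : X → X → Maybe ℕ)
                        (T : X → X → X × (X → Bool)) where
      mk : X → X → X → (X → Bool) → Formula → Formula
      mk x₀ x₁ s P ψ =
        if does (s ≟ x₀)
          then [ cone (fmap P (α x₀)) ] ψ
          else ¬' ([ cone (fmap P (α x₁)) ] ψ)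

      φ-rec : ℕ → X → X → Formula
      φ-rec zero x₀ x₁ = tt
      φ-rec (suc k) x₀ x₁ with I x₀ x₁ | T x₀ x₁
      ... | just 1             | (s , P) = mk x₀ x₁ s P tt
      ... | just (suc (suc _)) | (s , P) =
              mk x₀ x₁ s P
                 (⋁ (map (λ x₀' → ⋀ (map (λ x₁' → φ-rec k x₀' x₁')
                                         (filterB (not ∘ P) (allFin n))))
                         (filterB P (allFin n))))
      ... | _                  | _       = tt

      φ : X → X → Formula
      φ x₀ x₁ with I x₀ x₁
      ... | just i  = φ-rec i x₀ x₁
      ... | nothing = tt

module Submission where

-- For a pair (x₀,x₁) removed in round i+1 the algorithm records T(x₀,x₁) = (s,P)
-- with P a class of R_i on which Fχ_P separates α x₀ and α x₁ in the lifted
-- order.  The formula φ_{x₀,x₁} = [↑v]ψ (or ¬[↑v]ψ) is correct as soon as the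
-- subformula ψ defines P, i.e. ⟦ψ⟧ = χ_P: then ⟦[↑v]ψ⟧ x = ↑v(Fχ_P(α x)),
-- and reflexivity of the lifted order together with the recorded
-- non-inequality decide the two truth values (mk-correct).
-- For i = 0 the only class is X itself, defined by tt.  For i > 0 every pair
-- (a,b) split by the class P of R_i is already absent from R_i, hence was
-- removed in an earlier round and is distinguished by φ_{a,b} by induction;
-- then ⋁_{a∈P} ⋀_{b∉P} φ_{a,b} defines P (disjunction-of-separators).
-- This needs that classes of R_i separate R_i-unrelated points, i.e. that
-- R_i is transitive, which in turn rests on transitivity of the lifted order;
-- that is where preservation of weak pullbacks is used.

open import Defs
open import Data.Bool using (Bool; true; false; not; _∧_) renaming (_≤_ to _≤B_)
open import Data.Bool.Properties using (¬-not; ∧-zeroʳ) renaming (≤-refl to ≤B-refl; ≤-trans to ≤B-trans)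
open import Data.Nat using (ℕ; zero; suc; _≤_; _<_; _≤′_; ≤′-reflexive; ≤′-step; s≤s; _≤?_)
open import Data.Nat.Properties using (≤-refl; ≤-trans; <⇒≤; ≰⇒>; ≤⇒≤′)
open import Data.Fin using (Fin; _≟_)
open import Data.List using (List; []; _∷_; map; allFin)
open import Data.List.Relation.Unary.Any using (here; there)
open import Data.List.Membership.Propositional using (_∈_)
open import Data.List.Membership.Propositional.Properties using (∈-allFin; ∈-map⁺; ∈-map⁻)
open import Data.Maybe using (Maybe; just)
open import Data.Product using (Σ; _×_; _,_; proj₁; proj₂)
open import Data.Sum using (inj₁; inj₂)
open import Data.Empty using (⊥-elim)
open import Function using (_∘_; id)
open import Function.Bundles using (Equivalence)
open import Relation.Nullary using (¬_; yes; no)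
open import Relation.Binary.PropositionalEquality
  using (_≡_; refl; sym; trans; cong; subst; _≢_)

true≢false : true ≢ false
true≢false ()

≢true⇒≡false : ∀ {b} → b ≢ true → b ≡ false
≢true⇒≡false = ¬-not

-- The lifted relation of a preorder is a preorder; transitivity needs F to
-- preserve the weak pullback that composes two related pairs.
module LiftedPreorder (Fu : Functor) {Y : Set} (_≤_ : Y → Y → Set) where
  open Functor Fu

  Graph : Set
  Graph = Σ (Y × Y) (λ q → proj₁ q ≤ proj₂ q)

  src tgt : Graph → Y
  src = proj₁ ∘ proj₁
  tgt = proj₂ ∘ proj₁

  lift-refl : (∀ y → y ≤ y) → ∀ t → Lift Fu _≤_ t t
  lift-refl refl≤ t =
      fmap diag t
    , trans (sym (fmap-∘ diag src t)) (fmap-id t)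
    , trans (sym (fmap-∘ diag tgt t)) (fmap-id t)
    where
    diag : Y → Graph
    diag y = (y , y) , refl≤ y

  Composable : Set
  Composable = Σ (Graph × Graph) (λ q → tgt (proj₁ q) ≡ src (proj₂ q))

  first second : Composable → Graph
  first  = proj₁ ∘ proj₁
  second = proj₂ ∘ proj₁

  composable-pullback : IsWeakPullback tgt src first second
  composable-pullback = proj₂ , λ e₁ e₂ eq → ((e₁ , e₂) , eq) , refl , refl

  lift-trans : PreservesWeakPullbacks Fu → (∀ {x y z} → x ≤ y → y ≤ z → x ≤ z) →
               ∀ {t₀ t₁ t₂} → Lift Fu _≤_ t₀ t₁ → Lift Fu _≤_ t₁ t₂ → Lift Fu _≤_ t₀ t₂
  lift-trans wp trans≤ (u , u₀ , u₁) (w , w₁ , w₂)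
    with proj₂ (wp tgt src first second composable-pullback) u w (trans u₁ (sym w₁))
  ... | c , c₁ , c₂ =
      fmap compose c
    , trans (sym (fmap-∘ compose src c)) (trans (fmap-∘ first src c) (trans (cong (fmap src) c₁) u₀))
    , trans (sym (fmap-∘ compose tgt c)) (trans (fmap-∘ second tgt c) (trans (cong (fmap tgt) c₂) w₂))
    where
    compose : Composable → Graph
    compose ((e₁ , e₂) , eq) =
      (src e₁ , tgt e₂) , trans≤ (proj₂ e₁) (subst (_≤ tgt e₂) (sym eq) (proj₂ e₂))

module Connectives (Fu : Functor) {X : Set} (α : X → Functor.F Fu X) where
  open Semantics Fu α

  ⋀-true : ∀ (Φ : List (Formula Fu)) {y} → (∀ {φ} → φ ∈ Φ → ⟦ φ ⟧ y ≡ true) → ⟦ ⋀ Φ ⟧ y ≡ true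
  ⋀-true []      all = refl
  ⋀-true (φ ∷ Φ) all rewrite all (here refl) = ⋀-true Φ (all ∘ there)

  ⋀-false : ∀ {Φ φ y} → φ ∈ Φ → ⟦ φ ⟧ y ≡ false → ⟦ ⋀ Φ ⟧ y ≡ false
  ⋀-false {φ ∷ Φ}     (here refl) e rewrite e = refl
  ⋀-false {ψ ∷ Φ} {y = y} (there mem) e =
    trans (cong (⟦ ψ ⟧ y ∧_) (⋀-false mem e)) (∧-zeroʳ (⟦ ψ ⟧ y))

  ⋁-true : ∀ {Φ φ y} → φ ∈ Φ → ⟦ φ ⟧ y ≡ true → ⟦ ⋁ Fu Φ ⟧ y ≡ true
  ⋁-true mem e = cong not (⋀-false (∈-map⁺ ¬' mem) (cong not e))

  ⋁-false : ∀ (Φ : List (Formula Fu)) {y} → (∀ {φ} → φ ∈ Φ → ⟦ φ ⟧ y ≡ false) → ⟦ ⋁ Fu Φ ⟧ y ≡ false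
  ⋁-false Φ {y} none = cong not (⋀-true (map ¬' Φ) negated)
    where
    negated : ∀ {ψ} → ψ ∈ map ¬' Φ → ⟦ ψ ⟧ y ≡ true
    negated mem with ∈-map⁻ ¬' mem
    ... | φ , φ∈Φ , refl = cong not (none φ∈Φ)

module Proof (Fu : Functor) (wp : PreservesWeakPullbacks Fu)
  (cone : Functor.F Fu Bool → Functor.F Fu Bool → Bool) (isCone : IsCone Fu cone)
  (n : ℕ) (α : Fin n → Functor.F Fu (Fin n))
  (Rs : ℕ → Fin n → Fin n → Bool) (m : ℕ) (I : Fin n → Fin n → Maybe ℕ)
  (T : Fin n → Fin n → Fin n × (Fin n → Bool))
  (run : Algorithm.IsRun Fu α Rs m I T) where

  open Functor Fu
  open Algorithm Fu α
  open Construction cone I T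
  open Semantics Fu α
  open Connectives Fu α
  open IsRun run
  open LiftedPreorder Fu _≤B_ using (lift-refl; lift-trans)

  _≼_ : F Bool → F Bool → Set
  _≼_ = _≤F₂_ Fu

  ≼-refl : ∀ u → u ≼ u
  ≼-refl = lift-refl (λ _ → ≤B-refl)

  ≼-trans : ∀ {u v w} → u ≼ v → v ≼ w → u ≼ w
  ≼-trans = lift-trans wp ≤B-trans

  cone-true : ∀ {v u} → v ≼ u → cone v u ≡ true
  cone-true {v} {u} = Equivalence.from (isCone v u)

  cone-false : ∀ {v u} → ¬ (v ≼ u) → cone v u ≡ false
  cone-false {v} {u} v≰u = ≢true⇒≡false (v≰u ∘ Equivalence.to (isCone v u))

  shrinking : ∀ i {x y} → Rs (suc i) x y ≡ true → Rs i x y ≡ true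
  shrinking i {x} {y} = proj₁ ∘ Equivalence.to (step i x y)

  antitone : ∀ {a b x y} → a ≤′ b → Rs b x y ≡ true → Rs a x y ≡ true
  antitone (≤′-reflexive refl) = id
  antitone (≤′-step {b} a≤′b)  = antitone a≤′b ∘ shrinking b

  -- x and y are not split by any class of R (up to double negation).
  -- This form of "not removed" is visibly transitive.
  Agree : BRel → X → X → Set
  Agree R x y = ∀ P → IsClass R P →
                ¬ ¬ (fmap P (α x) ≼ fmap P (α y) × fmap P (α y) ≼ fmap P (α x))

  notRemoved⇒agree : ∀ {R x y} → ¬ Removed R x y → Agree R x y
  notRemoved⇒agree kept P cls both =
    kept (P , inj₁ (cls , λ xy → kept (P , inj₂ (cls , xy , λ yx → both (xy , yx)))))

  agree⇒notRemoved : ∀ {R x y} → Agree R x y → ¬ Removed R x y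
  agree⇒notRemoved agree (P , inj₁ (cls , x≰y))     = agree P cls (x≰y ∘ proj₁)
  agree⇒notRemoved agree (P , inj₂ (cls , _ , y≰x)) = agree P cls (y≰x ∘ proj₂)

  agree-trans : ∀ {R x y z} → Agree R x y → Agree R y z → Agree R x z
  agree-trans xy yz P cls both =
    xy P cls λ (x≤y , y≤x) → yz P cls λ (y≤z , z≤y) → both (≼-trans x≤y y≤z , ≼-trans z≤y y≤x)

  Rs-trans : ∀ i {x y z} → Rs i x y ≡ true → Rs i y z ≡ true → Rs i x z ≡ true
  Rs-trans zero    {x} {_} {z} _ _ = start x z
  Rs-trans (suc i) {x} {y} {z} rxy ryz
    with Equivalence.to (step i x y) rxy | Equivalence.to (step i y z) ryz
  ... | rxy′ , keptxy | ryz′ , keptyz =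
    Equivalence.from (step i x z)
      ( Rs-trans i rxy′ ryz′
      , agree⇒notRemoved (agree-trans (notRemoved⇒agree keptxy) (notRemoved⇒agree keptyz)))

  class-separates : ∀ {i P a b} → IsClass (Rs i) P → P a ≡ true → P b ≡ false → Rs i a b ≡ false
  class-separates {i} {P} {a} {b} (c , cls) pa pb = ≢true⇒≡false λ rab →
    true≢false (sym (trans (sym pb) (trans (cls b) (Rs-trans i (trans (sym (cls a)) pa) rab))))

  spec-class : ∀ {R x y s P} → TSpec R x y (s , P) → IsClass R P
  spec-class (inj₁ (_ , cls , _))     = cls
  spec-class (inj₂ (_ , cls , _ , _)) = cls

  Removal : ℕ → X → X → Set
  Removal i x y = i ≤ m × I x y ≡ just (suc i) × TSpec (Rs i) x y (T x y)

  earlier-removal : ∀ j x y → j ≤ m → Rs (suc j) x y ≡ false → Σ ℕ λ i → i ≤ j × Removal i x y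
  earlier-removal j x y j≤m gone
    with removed x y (≢true⇒≡false λ kept → true≢false (trans (sym (antitone (≤⇒≤′ (s≤s j≤m)) kept)) gone))
  ... | i , eI , ri , _ , spec with i ≤? j
  ...   | yes i≤j = i , i≤j , ≤-trans i≤j j≤m , eI , spec
  ...   | no  i≰j = ⊥-elim (true≢false (trans (sym (antitone (≤⇒≤′ (≰⇒> i≰j)) ri)) gone))

  Defines : Formula Fu → (X → Bool) → Set
  Defines ψ P = ∀ y → ⟦ ψ ⟧ y ≡ P y

  Distinguishes : Formula Fu → X → X → Set
  Distinguishes φ x₀ x₁ = x₀ ⊨ φ × ¬ (x₁ ⊨ φ)

  box-defined : ∀ {P} ψ l x → Defines ψ P → ⟦ [ l ] ψ ⟧ x ≡ l (fmap P (α x))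
  box-defined ψ l x def = cong l (fmap-cong def (α x))

  mk-correct : ∀ {R x₀ x₁ s P ψ} → TSpec R x₀ x₁ (s , P) → Defines ψ P →
               Distinguishes (mk x₀ x₁ s P ψ) x₀ x₁
  mk-correct {x₀ = x₀} {x₁} {P = P} {ψ} (inj₁ (refl , _ , x₀≰x₁)) def with x₀ ≟ x₀
  ... | no x₀≢x₀ = ⊥-elim (x₀≢x₀ refl)
  ... | yes _ =
      trans (box-defined ψ (cone v) x₀ def) (cone-true (≼-refl v))
    , λ holds → true≢false (trans (sym holds) (trans (box-defined ψ (cone v) x₁ def) (cone-false x₀≰x₁)))
    where
    v = fmap P (α x₀)
  mk-correct {x₀ = x₀} {x₁} {P = P} {ψ} (inj₂ (refl , _ , x₀≤x₁ , x₁≰x₀)) def with x₁ ≟ x₀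
  ... | yes refl = ⊥-elim (x₁≰x₀ x₀≤x₁)
  ... | no _ =
      cong not (trans (box-defined ψ (cone v) x₀ def) (cone-false x₁≰x₀))
    , λ holds → true≢false (trans (sym holds) (cong not (trans (box-defined ψ (cone v) x₁ def) (cone-true (≼-refl v)))))
    where
    v = fmap P (α x₁)

  ∈-filterB⁺ : ∀ p {a} (L : List X) → a ∈ L → p a ≡ true → a ∈ filterB p L
  ∈-filterB⁺ p (x ∷ L) mem pa with p x in px
  ∈-filterB⁺ p (x ∷ L) (here refl) pa | true  = here refl
  ∈-filterB⁺ p (x ∷ L) (there mem) pa | true  = there (∈-filterB⁺ p L mem pa)
  ∈-filterB⁺ p (x ∷ L) (here refl) pa | false with trans (sym pa) px
  ... | ()
  ∈-filterB⁺ p (x ∷ L) (there mem) pa | false = ∈-filterB⁺ p L mem pa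

  ∈-filterB⁻ : ∀ p {a} (L : List X) → a ∈ filterB p L → p a ≡ true
  ∈-filterB⁻ p (x ∷ L) mem with p x in px
  ∈-filterB⁻ p (x ∷ L) (here refl) | true  = px
  ∈-filterB⁻ p (x ∷ L) (there mem) | true  = ∈-filterB⁻ p L mem
  ∈-filterB⁻ p (x ∷ L) mem         | false = ∈-filterB⁻ p L mem

  inside : (X → Bool) → List X
  inside P = filterB P (allFin n)

  outside : (X → Bool) → List X
  outside P = filterB (not ∘ P) (allFin n)

  outside⁺ : ∀ (P : X → Bool) {b} → P b ≡ false → b ∈ outside P
  outside⁺ P {b} pb = ∈-filterB⁺ (not ∘ P) (allFin n) (∈-allFin b) (cong not pb)

  outside⁻ : ∀ (P : X → Bool) {b} → b ∈ outside P → P b ≡ false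
  outside⁻ P {b} mem with P b | ∈-filterB⁻ (not ∘ P) (allFin n) mem
  ... | false | _ = refl

  Separators : (X → Bool) → (X → X → Formula Fu) → Formula Fu
  Separators P δ = ⋁ Fu (map (λ a → ⋀ (map (δ a) (outside P))) (inside P))

  disjunction-of-separators : ∀ P δ → (∀ {a b} → P a ≡ true → P b ≡ false → Distinguishes (δ a b) a b) →
                              Defines (Separators P δ) P
  disjunction-of-separators P δ sep y with P y in py
  ... | true  = ⋁-true (∈-map⁺ _ (∈-filterB⁺ P (allFin n) (∈-allFin y) py))
                       (⋀-true (map (δ y) (outside P)) below)
    where
    below : ∀ {φ} → φ ∈ map (δ y) (outside P) → ⟦ φ ⟧ y ≡ true
    below mem with ∈-map⁻ (δ y) mem
    ... | b , b∉P , refl = proj₁ (sep py (outside⁻ P b∉P))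
  ... | false = ⋁-false _ beside
    where
    beside : ∀ {φ} → φ ∈ map (λ a → ⋀ (map (δ a) (outside P))) (inside P) → ⟦ φ ⟧ y ≡ false
    beside mem with ∈-map⁻ _ mem
    ... | a , a∈P , refl =
      ⋀-false (∈-map⁺ (δ a) (outside⁺ P py))
              (≢true⇒≡false (proj₂ (sep (∈-filterB⁻ P (allFin n) a∈P) py)))

  Body : ℕ → ℕ → (X → Bool) → Formula Fu
  Body k zero    P = tt Fu
  Body k (suc j) P = Separators P (φ-rec k)

  φ-rec-unfold : ∀ k i x₀ x₁ → I x₀ x₁ ≡ just (suc i) →
                 φ-rec (suc k) x₀ x₁ ≡ mk x₀ x₁ (proj₁ (T x₀ x₁)) (proj₂ (T x₀ x₁)) (Body k i (proj₂ (T x₀ x₁)))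
  φ-rec-unfold k zero    x₀ x₁ eI with I x₀ x₁ | eI | T x₀ x₁
  ... | .(just 1)             | refl | _ = refl
  φ-rec-unfold k (suc j) x₀ x₁ eI with I x₀ x₁ | eI | T x₀ x₁
  ... | .(just (suc (suc j))) | refl | _ = refl

  φ-unfold : ∀ {k} x₀ x₁ → I x₀ x₁ ≡ just k → φ x₀ x₁ ≡ φ-rec k x₀ x₁
  φ-unfold x₀ x₁ eI with I x₀ x₁ | eI
  ... | _ | refl = refl

  body-defines : ∀ k {i P} → i ≤ k → i ≤ m → IsClass (Rs i) P →
                 (∀ {i′ x y} → i′ < k → Removal i′ x y → Distinguishes (φ-rec k x y) x y) →
                 Defines (Body k i P) P
  body-defines k {zero}        _   _   (c , cls) _  y = sym (trans (cls y) (start c y))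
  body-defines k {suc j} {P} j<k j<m cls       IH =
    disjunction-of-separators P (φ-rec k) split-pair
    where
    split-pair : ∀ {a b} → P a ≡ true → P b ≡ false → Distinguishes (φ-rec k a b) a b
    split-pair {a} {b} pa pb with earlier-removal j a b (<⇒≤ j<m) (class-separates cls pa pb)
    ... | i′ , i′≤j , removal = IH (≤-trans (s≤s i′≤j) j<k) removal

  correct : ∀ k {i x₀ x₁} → i < k → Removal i x₀ x₁ → Distinguishes (φ-rec k x₀ x₁) x₀ x₁
  correct (suc k) {i} {x₀} {x₁} (s≤s i≤k) (i≤m , eI , spec) =
    subst (λ ψ → Distinguishes ψ x₀ x₁) (sym (φ-rec-unfold k i x₀ x₁ eI))
          (mk-correct spec (body-defines k i≤k i≤m (spec-class spec) (correct k)))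

  removed-pairs-distinguished : ∀ x₀ x₁ → Rs (suc m) x₀ x₁ ≡ false → Distinguishes (φ x₀ x₁) x₀ x₁
  removed-pairs-distinguished x₀ x₁ gone with earlier-removal m x₀ x₁ ≤-refl gone
  ... | i , _ , removal@(_ , eI , _) =
    subst (λ ψ → Distinguishes ψ x₀ x₁) (sym (φ-unfold x₀ x₁ eI)) (correct (suc i) ≤-refl removal)

proposition5 : (Fu : Functor) → PreservesWeakPullbacks Fu → HasSepMonotoneLiftings Fu →
    (cone : Functor.F Fu Bool → Functor.F Fu Bool → Bool) → IsCone Fu cone →
    (n : ℕ) (α : Fin n → Functor.F Fu (Fin n)) →
    (Rs : ℕ → Fin n → Fin n → Bool) (m : ℕ) (I : Fin n → Fin n → Maybe ℕ)
    (T : Fin n → Fin n → Fin n × (Fin n → Bool)) →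
    Algorithm.IsRun Fu α Rs m I T →
    (x₀ x₁ : Fin n) → Rs (suc m) x₀ x₁ ≡ false →
    Semantics._⊨_ Fu α x₀ (Algorithm.Construction.φ Fu α cone I T x₀ x₁) ×
    ¬ Semantics._⊨_ Fu α x₁ (Algorithm.Construction.φ Fu α cone I T x₀ x₁)
proposition5 Fu wp _ cone isCone n α Rs m I T run =
  Proof.removed-pairs-distinguished Fu wp cone isCone n α Rs m I T run
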